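{- Let $n\ge3$ and let $i,j,k\in[n]$ be pairwise distinct. Let $F=\{x\in\hat{\mathcal{E}}_n: x_{ij}=0,\ x_{jk}=0\}$. Among the defining inequalities $T_{rst}$ and $N_{rs}$ of $\hat{\mathcal{E}}_n$, those that hold with equality at every point of $F$ are exactly $N_{ij}$, $N_{jk}$, $N_{ik}$ and $T_{ijk}$.
   Context: Let $N_n=\{(r,s):1\le r,s\le n,\ r\ne s\}$; elements of $\mathbb{R}^{N_n}$ are $n\times n$ real matrices with the diagonal omitted. $\hat{\mathcal{E}}_n$ is the set of $x\in\mathbb{R}^{N_n}$ satisfying, for all pairwise distinct $r,s,t\in[n]$, the triangle inequalities $T_{rst}: x_{rs}+x_{st}-x_{rt}\ge0$ and the nonnegativity inequalities $N_{rs}: x_{rs}\ge0$.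
   Formalization: The coordinates $x_{rs}$ of points of $\hat{\mathcal{E}}_n$ and of $F$ are rational rather than real. -}

module Defs where

open import Data.Nat using (ℕ)
open import Data.Fin using (Fin)
open import Data.Rational using (ℚ; 0ℚ; _+_; _-_; _≤_)
open import Data.Product using (_×_)
open import Relation.Binary.PropositionalEquality using (_≡_; _≢_)

-- Points of ℝ^{N_n}: n×n matrices, diagonal entries are ignored
-- (no inequality ever mentions them). Scalars: ℚ.
Mat : ℕ → Set
Mat n = Fin n → Fin n → ℚ

data Ineq (n : ℕ) : Set where
  T : Fin n → Fin n → Fin n → Ineq n
  N : Fin n → Fin n → Ineq n

Valid : ∀ {n} → Ineq n → Set
Valid (T r s t) = r ≢ s × s ≢ t × r ≢ t
Valid (N r s)   = r ≢ s

lhs : ∀ {n} → Ineq n → Mat n → ℚ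
lhs (T r s t) x = (x r s + x s t) - x r t
lhs (N r s)   x = x r s

InE : ∀ {n} → Mat n → Set
InE {n} x = (ι : Ineq n) → Valid ι → 0ℚ ≤ lhs ι x

InF : ∀ {n} → Fin n → Fin n → Fin n → Mat n → Set
InF i j k x = InE x × x i j ≡ 0ℚ × x j k ≡ 0ℚ

TightOnF : ∀ {n} → Fin n → Fin n → Fin n → Ineq n → Set
TightOnF {n} i j k ι = (x : Mat n) → InF i j k x → lhs ι x ≡ 0ℚ

{-# OPTIONS --safe #-}
-- The four inequalities are tight: on F, T_ijk and N_ik squeeze x_ik between
-- x_ij + x_jk = 0 and 0. For the converse one point of F suffices at which
-- every other inequality is strict. It is pulled back from a 4 × 4 matrix
-- along the map sending i, j, k to 0, 1, 2 and every other index to 3; since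
-- that map is not injective, the 4 × 4 matrix is chosen strict also on the
-- degenerate inequalities (repeated indices), and then neither n ≥ 3 nor the
-- validity of ι is needed.
module Submission where

open import Defs
open import Data.Nat using (ℕ; _≥_; suc)
import Data.Nat as ℕ
open import Data.Fin using (Fin; inject₁; fromℕ)
open import Data.Fin.Patterns using (0F; 1F; 2F)
open import Data.Fin.Properties using (_≟_; any?; all?; inject₁-injective; fromℕ≢inject₁)
open import Data.Integer using (+_)
open import Data.Rational using (0ℚ; _+_; _-_; -_; _/_; _≤_; _<_)
open import Data.Rational.Properties
  using (_≤?_; _<?_; ≤-antisym; <⇒≢; neg-antimono-≤; +-identityˡ; +-0-group)
open import Algebra.Properties.Group +-0-group using (⁻¹-involutive)
open import Data.Product using (_×_; _,_)
open import Data.Sum using (_⊎_; inj₁; inj₂; [_,_]′)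
import Data.Sum as Sum
open import Data.Vec using (Vec; _∷_; []; lookup)
open import Data.Empty using (⊥-elim)
open import Function.Base using (id)
open import Function.Bundles using (_⇔_; mk⇔)
open import Function.Definitions using (Injective)
open import Relation.Nullary using (¬_; yes; no; contradiction)
open import Relation.Nullary.Decidable using (from-yes; _×-dec_; _⊎-dec_)
open import Relation.Binary.PropositionalEquality
  using (_≡_; _≢_; refl; sym; trans; cong; cong₂; subst; module ≡-Reasoning)
open ≡-Reasoning

private
  variable
    m n : ℕ

pullback : (Fin n → Fin m) → Mat m → Mat n
pullback f y r s = y (f r) (f s)

mapIneq : (Fin n → Fin m) → Ineq n → Ineq m
mapIneq f (T r s t) = T (f r) (f s) (f t)
mapIneq f (N r s)   = N (f r) (f s)

lhs-pullback : ∀ (f : Fin n → Fin m) y ι → lhs ι (pullback f y) ≡ lhs (mapIneq f ι) y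
lhs-pullback f y (T r s t) = refl
lhs-pullback f y (N r s)   = refl

InE-pullback : ∀ (f : Fin n → Fin m) {y} → (∀ ι → 0ℚ ≤ lhs ι y) → InE (pullback f y)
InE-pullback f {y} y≥0 ι _ = subst (0ℚ ≤_) (sym (lhs-pullback f y ι)) (y≥0 (mapIneq f ι))

T-injective : ∀ {r s t r′ s′ t′ : Fin n} → T r s t ≡ T r′ s′ t′ → r ≡ r′ × s ≡ s′ × t ≡ t′
T-injective refl = refl , refl , refl

N-injective : ∀ {r s r′ s′ : Fin n} → N r s ≡ N r′ s′ → r ≡ r′ × s ≡ s′
N-injective refl = refl , refl

mapIneq-reflects : ∀ {k} {f : Fin k → Fin n} {g : Fin n → Fin m} {h : Fin k → Fin m} →
  (∀ r a → g r ≡ h a → r ≡ f a) →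
  ∀ ι ι′ → mapIneq g ι ≡ mapIneq h ι′ → ι ≡ mapIneq f ι′
mapIneq-reflects reflects (T r s t) (T a b c) eq
  with T-injective eq
... | r≡ , s≡ , t≡
  rewrite reflects r a r≡ | reflects s b s≡ | reflects t c t≡ = refl
mapIneq-reflects reflects (N r s) (N a b) eq
  with N-injective eq
... | r≡ , s≡
  rewrite reflects r a r≡ | reflects s b s≡ = refl

locate : (Fin m → Fin n) → Fin n → Fin (suc m)
locate {m} f r with any? (λ a → f a ≟ r)
... | yes (a , _) = inject₁ a
... | no _        = fromℕ m

locate-image : ∀ {f : Fin m → Fin n} → Injective _≡_ _≡_ f → ∀ a → locate f (f a) ≡ inject₁ a
locate-image {f = f} f-injective a with any? (λ b → f b ≟ f a)
... | yes (b , fb≡fa) = cong inject₁ (f-injective fb≡fa)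
... | no  ∄b          = ⊥-elim (∄b (a , refl))

locate-reflects : ∀ (f : Fin m → Fin n) r a → locate f r ≡ inject₁ a → r ≡ f a
locate-reflects f r a eq with any? (λ b → f b ≟ r)
... | yes (b , fb≡r) = trans (sym fb≡r) (cong f (inject₁-injective eq))
... | no  _          = ⊥-elim (fromℕ≢inject₁ eq)

FaceEquation : Fin n → Fin n → Fin n → Ineq n → Set
FaceEquation i j k ι = ι ≡ N i j ⊎ ι ≡ N j k ⊎ ι ≡ N i k ⊎ ι ≡ T i j k

0≤-p⇒p≤0 : ∀ {p} → 0ℚ ≤ - p → p ≤ 0ℚ
0≤-p⇒p≤0 {p} 0≤-p = subst (_≤ 0ℚ) (⁻¹-involutive p) (neg-antimono-≤ 0≤-p)

strict⇒¬TightOnF : ∀ {i j k : Fin n} x ι → InF i j k x → 0ℚ < lhs ι x → ¬ TightOnF i j k ι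
strict⇒¬TightOnF x ι x∈F 0<lhs tight = <⇒≢ 0<lhs (sym (tight x x∈F))

generic : Mat 4
generic a b = + ((1 ℕ.+ lookup ρ a) ℕ.∸ lookup σ b) / 1
  where
  ρ σ : Vec ℕ 4
  ρ = 0 ∷ 1 ∷ 2 ∷ 2 ∷ []
  σ = 0 ∷ 1 ∷ 2 ∷ 0 ∷ []

generic-nonneg : ∀ ι → 0ℚ ≤ lhs ι generic
generic-nonneg (T a b c) =
  from-yes (all? λ a → all? λ b → all? λ c → 0ℚ ≤? lhs (T a b c) generic) a b c
generic-nonneg (N a b) = from-yes (all? λ a → all? λ b → 0ℚ ≤? generic a b) a b

generic-strict : ∀ ι → FaceEquation 0F 1F 2F ι ⊎ 0ℚ < lhs ι generic
generic-strict (T a b c) =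
  Sum.map₁ (λ { (refl , refl , refl) → inj₂ (inj₂ (inj₂ refl)) }) (strictᵀ a b c)
  where
  strictᵀ : ∀ a b c → (a ≡ 0F × b ≡ 1F × c ≡ 2F) ⊎ 0ℚ < lhs (T a b c) generic
  strictᵀ = from-yes (all? λ a → all? λ b → all? λ c →
    (a ≟ 0F ×-dec b ≟ 1F ×-dec c ≟ 2F) ⊎-dec 0ℚ <? lhs (T a b c) generic)
generic-strict (N a b) =
  Sum.map₁ (λ { (inj₁ (refl , refl))        → inj₁ refl
              ; (inj₂ (inj₁ (refl , refl))) → inj₂ (inj₁ refl)
              ; (inj₂ (inj₂ (refl , refl))) → inj₂ (inj₂ (inj₁ refl)) })
           (strictᴺ a b)
  where
  strictᴺ : ∀ a b → (a ≡ 0F × b ≡ 1F ⊎ a ≡ 1F × b ≡ 2F ⊎ a ≡ 0F × b ≡ 2F) ⊎ 0ℚ < generic a b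
  strictᴺ = from-yes (all? λ a → all? λ b →
    (a ≟ 0F ×-dec b ≟ 1F ⊎-dec a ≟ 1F ×-dec b ≟ 2F ⊎-dec a ≟ 0F ×-dec b ≟ 2F)
    ⊎-dec 0ℚ <? generic a b)

module _ {i j k : Fin n} (i≢j : i ≢ j) (j≢k : j ≢ k) (i≢k : i ≢ k) where

  InF⇒ik≡0 : ∀ {x} → InF i j k x → x i k ≡ 0ℚ
  InF⇒ik≡0 {x} (x∈E , ij≡0 , jk≡0) = ≤-antisym (0≤-p⇒p≤0 0≤-ik) (x∈E (N i k) i≢k)
    where
    T-ijk≡-ik : (x i j + x j k) - x i k ≡ - x i k
    T-ijk≡-ik = begin
      (x i j + x j k) - x i k  ≡⟨ cong (_- x i k) (cong₂ _+_ ij≡0 jk≡0) ⟩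
      0ℚ - x i k               ≡⟨ +-identityˡ (- x i k) ⟩
      - x i k                  ∎
    0≤-ik : 0ℚ ≤ - x i k
    0≤-ik = subst (0ℚ ≤_) T-ijk≡-ik (x∈E (T i j k) (i≢j , j≢k , i≢k))

  FaceEquation⇒TightOnF : ∀ ι → FaceEquation i j k ι → TightOnF i j k ι
  FaceEquation⇒TightOnF _ (inj₁ refl)               x (_ , ij≡0 , _)    = ij≡0
  FaceEquation⇒TightOnF _ (inj₂ (inj₁ refl))        x (_ , _ , jk≡0)    = jk≡0
  FaceEquation⇒TightOnF _ (inj₂ (inj₂ (inj₁ refl))) x x∈F               = InF⇒ik≡0 x∈F
  FaceEquation⇒TightOnF _ (inj₂ (inj₂ (inj₂ refl))) x x∈F@(_ , ij≡0 , jk≡0)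
    rewrite ij≡0 | jk≡0 | InF⇒ik≡0 x∈F = refl

  corner : Fin 3 → Fin n
  corner 0F = i
  corner 1F = j
  corner 2F = k

  corner-injective : Injective _≡_ _≡_ corner
  corner-injective {0F} {0F} _   = refl
  corner-injective {1F} {1F} _   = refl
  corner-injective {2F} {2F} _   = refl
  corner-injective {0F} {1F} i≡j = contradiction i≡j i≢j
  corner-injective {1F} {0F} j≡i = contradiction (sym j≡i) i≢j
  corner-injective {1F} {2F} j≡k = contradiction j≡k j≢k
  corner-injective {2F} {1F} k≡j = contradiction (sym k≡j) j≢k
  corner-injective {0F} {2F} i≡k = contradiction i≡k i≢k
  corner-injective {2F} {0F} k≡i = contradiction (sym k≡i) i≢k

  genericPoint : Mat n
  genericPoint = pullback (locate corner) generic

  genericPoint-∈F : InF i j k genericPoint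
  genericPoint-∈F = InE-pullback (locate corner) generic-nonneg
                  , cong₂ generic (role 0F) (role 1F)
                  , cong₂ generic (role 1F) (role 2F)
    where
    role : ∀ a → locate corner (corner a) ≡ inject₁ a
    role = locate-image corner-injective

  genericPoint-strict : ∀ ι → FaceEquation i j k ι ⊎ 0ℚ < lhs ι genericPoint
  genericPoint-strict ι =
    Sum.map lift (subst (0ℚ <_) (sym (lhs-pullback (locate corner) generic ι)))
            (generic-strict (mapIneq (locate corner) ι))
    where
    reflect : ∀ ι′ → mapIneq (locate corner) ι ≡ mapIneq inject₁ ι′ → ι ≡ mapIneq corner ι′
    reflect = mapIneq-reflects (locate-reflects corner) ι
    lift : FaceEquation 0F 1F 2F (mapIneq (locate corner) ι) → FaceEquation i j k ι
    lift = Sum.map (reflect (N 0F 1F)) (Sum.map (reflect (N 1F 2F))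
             (Sum.map (reflect (N 0F 2F)) (reflect (T 0F 1F 2F))))

  TightOnF⇒FaceEquation : ∀ ι → TightOnF i j k ι → FaceEquation i j k ι
  TightOnF⇒FaceEquation ι tight =
    [ id , (λ 0<lhs → contradiction tight (strict⇒¬TightOnF _ ι genericPoint-∈F 0<lhs)) ]′
      (genericPoint-strict ι)

mainTheorem4 : (n : ℕ) → n ≥ 3 → (i j k : Fin n) → i ≢ j → j ≢ k → i ≢ k →
    (ι : Ineq n) → Valid ι →
    (TightOnF i j k ι ⇔ (ι ≡ N i j ⊎ ι ≡ N j k ⊎ ι ≡ N i k ⊎ ι ≡ T i j k))
mainTheorem4 n _ i j k i≢j j≢k i≢k ι _ =
  mk⇔ (TightOnF⇒FaceEquation i≢j j≢k i≢k ι) (FaceEquation⇒TightOnF i≢j j≢k i≢k ι)
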